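{- Let $N=\{1,\dots,n\}$ be a set of jobs with first-stage processing times $p_1,\dots,p_n\ge 0$ and second-stage processing times $q_1,\dots,q_n\ge 0$, and let $M\subseteq N$. Define \[ f(M)=\min\Big\{\sum_{i\in N}\sum_{j\in N} p_j(n+1-i)x_{ij}+\sum_{i\in N}\sum_{j\in N} q_j(n+1-i)y_{ij}\ :\ \bm{x},\bm{y}\in\mathcal{X},\ x_{ij}=y_{ij}\ \forall i\in N,\ j\in M\Big\}. \] Compute the following: let $\bm{a}$ be the values $p_j$, $j\in N\setminus M$, sorted non-decreasingly; let $\bm{b}$ be the values $q_j$, $j\in N\setminus M$, sorted non-decreasingly; let $\bm{c}$ be the values $p_j+q_j$, $j\in M$; let $\bm{d}=\bm{a}+\bm{b}$ (componentwise sum of the two sorted vectors); and let $\bm{e}=(e_1,\dots,e_n)$ be the concatenation of $\bm{c}$ and $\bm{d}$ sorted non-decreasingly. Then \[ f(M)=\sum_{i=1}^{n}(n+1-i)e_i . \]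
   Context: $\mathcal{X}$ denotes the set of $n\times n$ permutation matrices, i.e. $\bm{x}\in\{0,1\}^{n\times n}$ with $\sum_{i\in N}x_{ij}=1$ for all $j\in N$ and $\sum_{j\in N}x_{ij}=1$ for all $i\in N$; $x_{ij}=1$ means job $j$ is scheduled in position $i$ of a single-machine schedule, so $\sum_{i,j}p_j(n+1-i)x_{ij}$ is the sum of completion times of that schedule.
   Formalization: The first-stage and second-stage processing times are rational rather than real. -}

module Defs where

open import Data.Nat using (ℕ; zero; suc; _∸_)
open import Data.Fin using (Fin; zero; suc; toℕ)
open import Data.Fin.Subset using (Subset; _∈_; _∉_; inside; outside)
open import Data.Bool using (Bool; true; false; not)
open import Data.Vec using (lookup)
open import Data.List using (List; []; _∷_; map; zipWith; _++_; filterᵇ; allFin)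
open import Data.Integer using (+_)
open import Data.Rational using (ℚ; 0ℚ; 1ℚ; _+_; _*_; _/_; _≤_)
import Data.Rational.Properties as ℚP
open import Data.List.Sort ℚP.≤-decTotalOrder using (sort)
open import Data.Sum using (_⊎_)
open import Data.Product using (_×_)
open import Relation.Binary.PropositionalEquality using (_≡_)

ℕ→ℚ : ℕ → ℚ
ℕ→ℚ k = + k / 1

sumFin : ∀ {n} → (Fin n → ℚ) → ℚ
sumFin {zero}  f = 0ℚ
sumFin {suc n} f = f zero + sumFin (λ i → f (suc i))

IsPermMatrix : ∀ n → (Fin n → Fin n → ℚ) → Set
IsPermMatrix n x =
  (∀ i j → x i j ≡ 0ℚ ⊎ x i j ≡ 1ℚ) × ((∀ j → sumFin (λ i → x i j) ≡ 1ℚ) × (∀ i → sumFin (λ j → x i j) ≡ 1ℚ))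

-- position i (0-based here, i.e. paper position toℕ i + 1) has weight n + 1 - (toℕ i + 1) = n ∸ toℕ i
weight : ∀ n → Fin n → ℚ
weight n i = ℕ→ℚ (n ∸ toℕ i)

cost : ∀ n → (Fin n → ℚ) → (Fin n → Fin n → ℚ) → ℚ
cost n p x = sumFin (λ i → sumFin (λ j → p j * weight n i * x i j))

objective : ∀ n → (p q : Fin n → ℚ) → (x y : Fin n → Fin n → ℚ) → ℚ
objective n p q x y = cost n p x + cost n q y

Feasible : ∀ n → Subset n → (x y : Fin n → Fin n → ℚ) → Set
Feasible n M x y = IsPermMatrix n x × (IsPermMatrix n y × (∀ i j → j ∈ M → x i j ≡ y i j))

inM : ∀ {n} → Subset n → List (Fin n)
inM {n} M = filterᵇ (λ j → lookup M j) (allFin n)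

notInM : ∀ {n} → Subset n → List (Fin n)
notInM {n} M = filterᵇ (λ j → not (lookup M j)) (allFin n)

eVec : ∀ n → (p q : Fin n → ℚ) → Subset n → List ℚ
eVec n p q M = sort (c ++ d)
  where
    a b c d : List ℚ
    a = sort (map p (notInM M))
    b = sort (map q (notInM M))
    c = map (λ j → p j + q j) (inM M)
    d = zipWith _+_ a b

wsum : ℕ → List ℚ → ℚ
wsum k [] = 0ℚ
wsum k (e ∷ es) = ℕ→ℚ k * e + wsum (k ∸ 1) es

-- A pair of permutation matrices (x, y) is a pair of schedules σ, τ (position ↦ job), and the
-- constraints x_ij = y_ij for j ∈ M say that at every position either both stages run the same
-- job or both run jobs outside M. The objective is Σ_i w_i (p_{σ i} + q_{τ i}) with decreasing
-- weights w_i = n + 1 - i. On the positions running jobs outside M, the rearrangement inequality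
-- bounds the p-part and the q-part separately, by pairing those weights with a and with b, hence
-- together by pairing them with d = a + b. Adding the positions running jobs of M pairs all the
-- weights with the values c ++ d, and a second use of the rearrangement inequality gives the lower
-- bound Σ_i w_i e_i. It is attained by running, in increasing order of p + q, the pairs (j, j) for
-- j ∈ M and the pairs of the k-th smallest p-job with the k-th smallest q-job outside M.
module Submission where

open import Defs
open import Data.Bool using (Bool; true; false; not; T; if_then_else_)
open import Data.Empty using (⊥-elim)
open import Data.Fin as Fin using (Fin; zero; suc)
open import Data.Fin.Subset using (Subset; _∈_; _∉_)
open import Data.Fin.Subset.Properties using (_∈?_)
import Data.Integer as ℤ
import Data.Integer.Properties as ℤP
open import Data.List as List
  using (List; []; _∷_; _++_; map; foldr; zip; zipWith; length; allFin; tabulate; filterᵇ)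
import Data.List.Properties as ListP
open import Data.List.Membership.Propositional using () renaming (_∈_ to _∈ᴸ_)
open import Data.List.Membership.Propositional.Properties using (∈-map⁻; ∈-map⁺; ∈-∃++; ∈-allFin)
open import Data.List.Membership.Propositional.Properties.WithK using (unique∧set⇒bag)
open import Data.List.Relation.Binary.BagAndSetEquality using (∼bag⇒↭)
open import Data.List.Relation.Binary.Permutation.Propositional
  using (_↭_; ↭-refl; ↭-reflexive; ↭-sym; ↭-trans; ↭-prep; ↭-swap; ↭⇒↭ₛ; module PermutationReasoning)
import Data.List.Relation.Binary.Permutation.Propositional.Properties as ↭
import Data.List.Relation.Binary.Permutation.Setoid.Properties as ↭ₛ
open import Data.List.Relation.Binary.Pointwise using (Pointwise-≡⇒≡)
open import Data.List.Relation.Unary.All as All using (All; []; _∷_)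
import Data.List.Relation.Unary.All.Properties as All
open import Data.List.Relation.Unary.AllPairs using (AllPairs; []; _∷_)
import Data.List.Relation.Unary.AllPairs.Properties as AllPairs
open import Data.List.Relation.Unary.Any using (here; there)
open import Data.List.Relation.Unary.Linked using (Linked)
import Data.List.Relation.Unary.Linked.Properties as Linked
open import Data.List.Relation.Unary.Sorted.TotalOrder.Properties using (↗↭↗⇒≋)
import Data.List.Relation.Unary.Unique.Propositional.Properties as Unique
import Data.List.Sort as Sort
open import Data.Nat as ℕ using (ℕ; zero; suc)
import Data.Nat.Coprimality as Coprimality
import Data.Nat.Properties as ℕP
open import Data.Product using (_×_; _,_; proj₁; proj₂; Σ-syntax; uncurry)
open import Data.Rational as ℚ using (ℚ; 0ℚ; 1ℚ; _+_; _*_; _-_; -_; _≤_; _≥_)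
import Data.Rational.Properties as ℚP
open import Data.Rational.Solver using (module +-*-Solver)
open import Data.Sum using (_⊎_; inj₁; inj₂)
open import Data.Vec using (lookup)
open import Data.Vec.Properties using ([]=⇒lookup; lookup⇒[]=)
open import Function using (_∘_; id)
open import Function.Bundles using (mk⇔)
open import Relation.Binary.Bundles using (DecTotalOrder)
import Relation.Binary.Construct.On as On
open import Relation.Binary.PropositionalEquality
open import Relation.Nullary using (does; yes; no)
open import Relation.Nullary.Decidable using (T?)

open Sort ℚP.≤-decTotalOrder using (sort; sort-↭; sort-↗)

ℕ→ℚ-mono-≤ : ∀ {j m} → j ℕ.≤ m → ℕ→ℚ j ≤ ℕ→ℚ m
ℕ→ℚ-mono-≤ {j} {m} j≤m = subst₂ _≤_ (sym (as-mkℚ j)) (sym (as-mkℚ m))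
  (ℚ.*≤* (subst₂ ℤ._≤_ (sym (ℤP.*-identityʳ (ℤ.+ j))) (sym (ℤP.*-identityʳ (ℤ.+ m)))
                       (ℤ.+≤+ j≤m)))
  where
  as-mkℚ : ∀ k → ℕ→ℚ k ≡ ℚ.mkℚ (ℤ.+ k) 0 (Coprimality.sym (Coprimality.1-coprimeTo k))
  as-mkℚ k = ℚP.normalize-coprime (Coprimality.sym (Coprimality.1-coprimeTo k))

1+nonNeg≢0 : ∀ {a} → 0ℚ ≤ a → 1ℚ + a ≢ 0ℚ
1+nonNeg≢0 {a} 0≤a 1+a≡0 = ℚP.<-irrefl refl (begin-strict
  0ℚ       <⟨ ℚP.positive⁻¹ 1ℚ ⟩
  1ℚ       ≡⟨ ℚP.+-identityʳ 1ℚ ⟨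
  1ℚ + 0ℚ  ≤⟨ ℚP.+-monoʳ-≤ 1ℚ 0≤a ⟩
  1ℚ + a   ≡⟨ 1+a≡0 ⟩
  0ℚ       ∎)
  where open ℚP.≤-Reasoning

p+q≡p⇒q≡0 : ∀ a b → a + b ≡ a → b ≡ 0ℚ
p+q≡p⇒q≡0 a b a+b≡a = begin
  b            ≡⟨ solve 2 (λ a b → b := (:- a) :+ (a :+ b)) refl a b ⟩
  - a + (a + b) ≡⟨ cong (- a +_) a+b≡a ⟩
  - a + a      ≡⟨ ℚP.+-inverseˡ a ⟩
  0ℚ           ∎
  where
  open ≡-Reasoning
  open +-*-Solver

*-distribˡ-+-shuffle : ∀ a b c x y → a * (b + c) + (x + y) ≡ (a * b + x) + (a * c + y)
*-distribˡ-+-shuffle = solve 5 (λ a b c x y → a :* (b :+ c) :+ (x :+ y) := (a :* b :+ x) :+ (a :* c :+ y)) refl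
  where open +-*-Solver

exchange-≤ : ∀ {w z v y} → z ≤ w → v ≤ y → w * v + z * y ≤ w * y + z * v
exchange-≤ {w} {z} {v} {y} z≤w v≤y = begin
  w * v + z * y                  ≡⟨ regroup v y ⟩
  (w - z) * v + (z * v + z * y)  ≤⟨ ℚP.+-monoˡ-≤ (z * v + z * y) (ℚP.*-monoˡ-≤-nonNeg (w - z) v≤y) ⟩
  (w - z) * y + (z * v + z * y)  ≡⟨ cong ((w - z) * y +_) (ℚP.+-comm (z * v) (z * y)) ⟩
  (w - z) * y + (z * y + z * v)  ≡⟨ regroup y v ⟨
  w * y + z * v                  ∎
  where
  open ℚP.≤-Reasoning
  instance
    w-z≥0 : ℚ.NonNegative (w - z)
    w-z≥0 = ℚ.nonNegative (subst (_≤ w - z) (ℚP.+-inverseʳ z) (ℚP.+-monoˡ-≤ (- z) z≤w))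
  regroup : ∀ s t → w * s + z * t ≡ (w - z) * s + (z * s + z * t)
  regroup = solve 4 (λ w z s t → w :* s :+ z :* t := (w :- z) :* s :+ (z :* s :+ z :* t)) refl w z
    where open +-*-Solver

sumᴸ : List ℚ → ℚ
sumᴸ = foldr _+_ 0ℚ

sumᴸ-++ : ∀ xs ys → sumᴸ (xs ++ ys) ≡ sumᴸ xs + sumᴸ ys
sumᴸ-++ []       ys = sym (ℚP.+-identityˡ (sumᴸ ys))
sumᴸ-++ (x ∷ xs) ys = trans (cong (x +_) (sumᴸ-++ xs ys)) (sym (ℚP.+-assoc x (sumᴸ xs) (sumᴸ ys)))

sumᴸ-↭ : ∀ {xs ys} → xs ↭ ys → sumᴸ xs ≡ sumᴸ ys
sumᴸ-↭ xs↭ys = ↭ₛ.foldr-commMonoid (setoid ℚ) ℚP.+-0-isCommutativeMonoid (↭⇒↭ₛ xs↭ys)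

pairing : List (ℚ × ℚ) → ℚ
pairing ps = sumᴸ (map (uncurry _*_) ps)

pairing-↭ : ∀ {ps qs} → ps ↭ qs → pairing ps ≡ pairing qs
pairing-↭ ps↭qs = sumᴸ-↭ (↭.map⁺ (uncurry _*_) ps↭qs)

pairing-++ : ∀ ps qs → pairing (ps ++ qs) ≡ pairing ps + pairing qs
pairing-++ ps qs =
  trans (cong sumᴸ (ListP.map-++ (uncurry _*_) ps qs)) (sumᴸ-++ (map (uncurry _*_) ps) (map (uncurry _*_) qs))

pairing-map-+ : ∀ {A : Set} (w s t : A → ℚ) K →
  pairing (map (λ i → (w i , s i + t i)) K)
    ≡ pairing (map (λ i → (w i , s i)) K) + pairing (map (λ i → (w i , t i)) K)
pairing-map-+ w s t []      = sym (ℚP.+-identityˡ 0ℚ)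
pairing-map-+ w s t (i ∷ K) = trans (cong (w i * (s i + t i) +_) (pairing-map-+ w s t K))
  (*-distribˡ-+-shuffle (w i) (s i) (t i) _ _)

dot : List ℚ → List ℚ → ℚ
dot ws vs = pairing (zip ws vs)

dot-zipWith-+ : ∀ ws as bs → length as ≡ length bs →
  dot ws (zipWith _+_ as bs) ≡ dot ws as + dot ws bs
dot-zipWith-+ []       _        _        _  = sym (ℚP.+-identityˡ 0ℚ)
dot-zipWith-+ (_ ∷ _)  []       []       _  = sym (ℚP.+-identityˡ 0ℚ)
dot-zipWith-+ (w ∷ ws) (a ∷ as) (b ∷ bs) eq =
  trans (cong (w * (a + b) +_) (dot-zipWith-+ ws as bs (ℕP.suc-injective eq)))
        (*-distribˡ-+-shuffle w a b _ _)

∈-map⇒↭∷ : ∀ {A B : Set} (f : A → B) {b xs} → b ∈ᴸ map f xs →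
  Σ[ x ∈ A ] Σ[ ys ∈ List A ] (f x ≡ b × xs ↭ x ∷ ys)
∈-map⇒↭∷ f b∈
  with x , x∈xs , refl ← ∈-map⁻ f b∈
  with ys , zs , refl ← ∈-∃++ x∈xs
  = x , ys ++ zs , refl , ↭.shift x ys zs

partitionᵇ-↭ : ∀ {A : Set} (t : A → Bool) xs → filterᵇ t xs ++ filterᵇ (not ∘ t) xs ↭ xs
partitionᵇ-↭ t []       = ↭-refl
partitionᵇ-↭ t (x ∷ xs) with t x
... | true  = ↭-prep x (partitionᵇ-↭ t xs)
... | false = ↭-trans (↭.shift x (filterᵇ t xs) _) (↭-prep x (partitionᵇ-↭ t xs))

filterᵇ-map : ∀ {A B : Set} (t : B → Bool) (f : A → B) xs →
  filterᵇ t (map f xs) ≡ map f (filterᵇ (t ∘ f) xs)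
filterᵇ-map t f []       = refl
filterᵇ-map t f (x ∷ xs) with t (f x)
... | true  = cong (f x ∷_) (filterᵇ-map t f xs)
... | false = filterᵇ-map t f xs

filterᵇ-cong : ∀ {A : Set} {t t′ : A → Bool} → (∀ x → t x ≡ t′ x) →
  ∀ xs → filterᵇ t xs ≡ filterᵇ t′ xs
filterᵇ-cong {t = t} {t′} t≗t′ =
  ListP.filter-≐ (T? ∘ t) (T? ∘ t′) ((λ {x} → subst T (t≗t′ x)) , (λ {x} → subst T (sym (t≗t′ x))))

pairing-map-partition : ∀ {A : Set} (h : A → ℚ × ℚ) (t : A → Bool) xs →
  pairing (map h xs) ≡ pairing (map h (filterᵇ t xs)) + pairing (map h (filterᵇ (not ∘ t) xs))
pairing-map-partition h t xs = begin
  pairing (map h xs)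
    ≡⟨ pairing-↭ (↭.map⁺ h (partitionᵇ-↭ t xs)) ⟨
  pairing (map h (filterᵇ t xs ++ filterᵇ (not ∘ t) xs))
    ≡⟨ cong pairing (ListP.map-++ h (filterᵇ t xs) _) ⟩
  pairing (map h (filterᵇ t xs) ++ map h (filterᵇ (not ∘ t) xs))
    ≡⟨ pairing-++ (map h (filterᵇ t xs)) _ ⟩
  pairing (map h (filterᵇ t xs)) + pairing (map h (filterᵇ (not ∘ t) xs)) ∎
  where open ≡-Reasoning

map-proj₁-zip : ∀ {A B : Set} (xs : List A) (ys : List B) → length xs ≡ length ys →
  map proj₁ (zip xs ys) ≡ xs
map-proj₁-zip []       []       _  = refl
map-proj₁-zip (x ∷ xs) (y ∷ ys) eq = cong (x ∷_) (map-proj₁-zip xs ys (ℕP.suc-injective eq))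

map-proj₂-zip : ∀ {A B : Set} (xs : List A) (ys : List B) → length xs ≡ length ys →
  map proj₂ (zip xs ys) ≡ ys
map-proj₂-zip []       []       _  = refl
map-proj₂-zip (x ∷ xs) (y ∷ ys) eq = cong (y ∷_) (map-proj₂-zip xs ys (ℕP.suc-injective eq))

map-pair : ∀ {A B C : Set} (f : A → B) (g : A → C) xs →
  map (λ x → (f x , g x)) xs ≡ zip (map f xs) (map g xs)
map-pair f g []       = refl
map-pair f g (x ∷ xs) = cong ((f x , g x) ∷_) (map-pair f g xs)

all-zip : ∀ {A B : Set} {P : A → Set} {Q : B → Set} {xs ys} → All P xs → All Q ys →
  All (λ t → P (proj₁ t) × Q (proj₂ t)) (zip xs ys)
all-zip []         _          = []
all-zip (_ ∷ _)    []         = []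
all-zip (px ∷ pxs) (qy ∷ qys) = (px , qy) ∷ all-zip pxs qys

fromList : ∀ {A : Set} (xs : List A) {n} → length xs ≡ n → Fin n → A
fromList xs refl = List.lookup xs

map-fromList : ∀ {A : Set} (xs : List A) {n} (eq : length xs ≡ n) →
  map (fromList xs eq) (allFin n) ≡ xs
map-fromList xs refl = trans (ListP.map-tabulate id (List.lookup xs)) (ListP.tabulate-lookup xs)

sorted-↭⇒≡ : ∀ {xs ys} → Linked _≤_ xs → Linked _≤_ ys → xs ↭ ys → xs ≡ ys
sorted-↭⇒≡ xs↗ ys↗ xs↭ys = Pointwise-≡⇒≡
  (↗↭↗⇒≋ (DecTotalOrder.totalOrder ℚP.≤-decTotalOrder) xs↗ ys↗ (↭⇒↭ₛ xs↭ys))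

sort-↭-cong : ∀ {xs ys} → xs ↭ ys → sort xs ≡ sort ys
sort-↭-cong {xs} {ys} xs↭ys =
  sorted-↭⇒≡ (sort-↗ xs) (sort-↗ ys) (↭-trans (sort-↭ xs) (↭-trans xs↭ys (↭-sym (sort-↭ ys))))

sort-allPairs : ∀ xs → AllPairs _≤_ (sort xs)
sort-allPairs xs = Linked.Linked⇒AllPairs ℚP.≤-trans (sort-↗ xs)

length-sort-map : ∀ {A : Set} (f : A → ℚ) K → length (sort (map f K)) ≡ length K
length-sort-map f K = trans (↭.↭-length (sort-↭ (map f K))) (ListP.length-map f K)

module SortOn {A : Set} (key : A → ℚ) where
  open Sort (On.decTotalOrder ℚP.≤-decTotalOrder key) public
    using () renaming (sort to sortOn; sort-↭ to sortOn-↭)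
  open Sort (On.decTotalOrder ℚP.≤-decTotalOrder key) using () renaming (sort-↗ to sortOn-↗)

  map-sortOn : ∀ xs → map key (sortOn xs) ≡ sort (map key xs)
  map-sortOn xs = sorted-↭⇒≡ (Linked.map⁺ (sortOn-↗ xs)) (sort-↗ (map key xs))
    (↭-trans (↭.map⁺ key (sortOn-↭ xs)) (↭-sym (sort-↭ (map key xs))))

-- Swapping the partners of w and of v does not increase the sum, by exchange-≤.
pull-extremes : ∀ {w v} L → w ∈ᴸ map proj₁ L → v ∈ᴸ map proj₂ L →
  All (_≤ w) (map proj₁ L) → All (v ≤_) (map proj₂ L) →
  Σ[ R ∈ List (ℚ × ℚ) ] (map proj₁ L ↭ w ∷ map proj₁ R × map proj₂ L ↭ v ∷ map proj₂ R
                         × w * v + pairing R ≤ pairing L)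
pull-extremes L w∈ v∈ w≥L v≤L with ∈-map⇒↭∷ proj₁ w∈
... | (w , y) , K , refl , L↭ with ↭.∈-resp-↭ (↭.map⁺ proj₂ L↭) v∈
...   | here refl = K , ↭.map⁺ proj₁ L↭ , ↭.map⁺ proj₂ L↭ , ℚP.≤-reflexive (sym (pairing-↭ L↭))
...   | there v∈K with ∈-map⇒↭∷ proj₂ v∈K
...     | (z , v) , K′ , refl , K↭ = (z , y) ∷ K′ , ↭.map⁺ proj₁ L↭′ , seconds , exchanged
  where
  L↭′ : L ↭ (w , y) ∷ (z , v) ∷ K′
  L↭′ = ↭-trans L↭ (↭-prep (w , y) K↭)
  seconds : map proj₂ L ↭ v ∷ y ∷ map proj₂ K′
  seconds = ↭-trans (↭.map⁺ proj₂ L↭′) (↭-swap y v ↭-refl)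
  exchanged : w * v + (z * y + pairing K′) ≤ pairing L
  exchanged
    with _ ∷ z≤w ∷ _ ← ↭.All-resp-↭ (↭.map⁺ proj₁ L↭′) w≥L
    with v≤y ∷ _ ← ↭.All-resp-↭ (↭.map⁺ proj₂ L↭′) v≤L = begin
    w * v + (z * y + pairing K′)      ≡⟨ ℚP.+-assoc (w * v) (z * y) _ ⟨
    w * v + z * y + pairing K′        ≤⟨ ℚP.+-monoˡ-≤ (pairing K′) (exchange-≤ z≤w v≤y) ⟩
    w * y + z * v + pairing K′        ≡⟨ ℚP.+-assoc (w * y) (z * v) _ ⟩
    pairing ((w , y) ∷ (z , v) ∷ K′)  ≡⟨ pairing-↭ L↭′ ⟨
    pairing L                         ∎
    where open ℚP.≤-Reasoning

rearrangement : ∀ {ws vs} L → AllPairs _≥_ ws → AllPairs _≤_ vs →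
  ws ↭ map proj₁ L → vs ↭ map proj₂ L → dot ws vs ≤ pairing L
rearrangement {[]} {vs} [] _ _ _ _ = ℚP.≤-refl
rearrangement {[]} (_ ∷ _) _ _ ws↭ _ with () ← ↭.↭-empty-inv (↭-sym ws↭)
rearrangement {_ ∷ _} [] _ _ ws↭ _ with () ← ↭.↭-empty-inv ws↭
rearrangement {_ ∷ _} {[]} (_ ∷ _) _ _ _ vs↭ with () ← ↭.↭-empty-inv (↭-sym vs↭)
rearrangement {w ∷ ws} {v ∷ vs} L@(_ ∷ _) (w≥ws ∷ ws↘) (v≤vs ∷ vs↗) ws↭ vs↭
  with R , L₁↭ , L₂↭ , pulled ← pull-extremes L
         (↭.∈-resp-↭ ws↭ (here refl)) (↭.∈-resp-↭ vs↭ (here refl))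
         (↭.All-resp-↭ ws↭ (ℚP.≤-refl ∷ w≥ws)) (↭.All-resp-↭ vs↭ (ℚP.≤-refl ∷ v≤vs))
  = ℚP.≤-trans (ℚP.+-monoʳ-≤ (w * v) (rearrangement R ws↘ vs↗ (↭.drop-∷ (↭-trans ws↭ L₁↭))
                                                               (↭.drop-∷ (↭-trans vs↭ L₂↭))))
               pulled

rearrangement-map : ∀ {A : Set} (w s : A → ℚ) K → AllPairs (λ i j → w i ≥ w j) K →
  dot (map w K) (sort (map s K)) ≤ pairing (map (λ i → (w i , s i)) K)
rearrangement-map w s K w↘ = rearrangement (map (λ i → (w i , s i)) K)
  (AllPairs.map⁺ w↘) (sort-allPairs (map s K))
  (↭-reflexive (ListP.map-∘ K)) (↭-trans (sort-↭ (map s K)) (↭-reflexive (ListP.map-∘ K)))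

two-sorted-sums-bound : ∀ {A : Set} (w s t : A → ℚ) K → AllPairs (λ i j → w i ≥ w j) K →
  dot (map w K) (zipWith _+_ (sort (map s K)) (sort (map t K)))
    ≤ pairing (map (λ i → (w i , s i + t i)) K)
two-sorted-sums-bound w s t K w↘ = begin
  dot (map w K) (zipWith _+_ (sort (map s K)) (sort (map t K)))
    ≡⟨ dot-zipWith-+ (map w K) _ _ (trans (length-sort-map s K) (sym (length-sort-map t K))) ⟩
  dot (map w K) (sort (map s K)) + dot (map w K) (sort (map t K))
    ≤⟨ ℚP.+-mono-≤ (rearrangement-map w s K w↘) (rearrangement-map w t K w↘) ⟩
  pairing (map (λ i → (w i , s i)) K) + pairing (map (λ i → (w i , t i)) K)
    ≡⟨ pairing-map-+ w s t K ⟨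
  pairing (map (λ i → (w i , s i + t i)) K) ∎
  where open ℚP.≤-Reasoning

sumFin-cong : ∀ {n} {f g : Fin n → ℚ} → (∀ i → f i ≡ g i) → sumFin f ≡ sumFin g
sumFin-cong {zero}  f≗g = refl
sumFin-cong {suc n} f≗g = cong₂ _+_ (f≗g zero) (sumFin-cong (f≗g ∘ suc))

sumFin-zero : ∀ {n} {f : Fin n → ℚ} → (∀ i → f i ≡ 0ℚ) → sumFin f ≡ 0ℚ
sumFin-zero {zero}  f≗0 = refl
sumFin-zero {suc n} f≗0 = trans (cong₂ _+_ (f≗0 zero) (sumFin-zero (f≗0 ∘ suc))) (ℚP.+-identityˡ 0ℚ)

sumFin-head : ∀ {n} (f : Fin (suc n) → ℚ) {a c} → f zero ≡ a → sumFin f ≡ c →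
  a + sumFin (f ∘ suc) ≡ c
sumFin-head f refl sum≡c = sum≡c

sumFin-tail : ∀ {n} (f : Fin (suc n) → ℚ) {c} → f zero ≡ 0ℚ → sumFin f ≡ c → sumFin (f ∘ suc) ≡ c
sumFin-tail f f₀≡0 sum≡c = trans (sym (ℚP.+-identityˡ _)) (sumFin-head f f₀≡0 sum≡c)

sumFin-as-sumᴸ : ∀ {n} (f : Fin n → ℚ) → sumFin f ≡ sumᴸ (map f (allFin n))
sumFin-as-sumᴸ {n} f = trans (as-tabulate f) (cong sumᴸ (sym (ListP.map-tabulate id f)))
  where
  as-tabulate : ∀ {m} (g : Fin m → ℚ) → sumFin g ≡ sumᴸ (tabulate g)
  as-tabulate {zero}  g = refl
  as-tabulate {suc m} g = cong (g zero +_) (as-tabulate (g ∘ suc))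

sumFin-as-pairing : ∀ {n} (w s : Fin n → ℚ) →
  sumFin (λ i → w i * s i) ≡ pairing (map (λ i → (w i , s i)) (allFin n))
sumFin-as-pairing {n} w s = trans (sumFin-as-sumᴸ (λ i → w i * s i)) (cong sumᴸ (ListP.map-∘ (allFin n)))

-- Defined through Fin._≟_ so that δ (suc i) (suc j) reduces to δ i j.
δ : ∀ {n} → Fin n → Fin n → ℚ
δ i j = if does (i Fin.≟ j) then 1ℚ else 0ℚ

δ-zeroOne : ∀ {n} (i j : Fin n) → δ i j ≡ 0ℚ ⊎ δ i j ≡ 1ℚ
δ-zeroOne i j with does (i Fin.≟ j)
... | true  = inj₂ refl
... | false = inj₁ refl

δ-diag : ∀ {n} (i : Fin n) → δ i i ≡ 1ℚ
δ-diag zero    = refl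
δ-diag (suc i) = δ-diag i

δ-off : ∀ {n} {i j : Fin n} → i ≢ j → δ i j ≡ 0ℚ
δ-off {i = i} {j} i≢j with i Fin.≟ j
... | yes i≡j = ⊥-elim (i≢j i≡j)
... | no  _   = refl

δ≡1⇒≡ : ∀ {n} {i j : Fin n} → δ i j ≡ 1ℚ → i ≡ j
δ≡1⇒≡ {i = i} {j} δ≡1 with i Fin.≟ j
... | yes i≡j = i≡j
... | no  _   with () ← δ≡1

δ-sym : ∀ {n} (i j : Fin n) → δ i j ≡ δ j i
δ-sym zero    zero    = refl
δ-sym zero    (suc j) = refl
δ-sym (suc i) zero    = refl
δ-sym (suc i) (suc j) = δ-sym i j

sumFin-δ : ∀ {n} (g : Fin n → ℚ) (a : Fin n) → sumFin (λ j → g j * δ a j) ≡ g a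
sumFin-δ {suc n} g zero = begin
  g zero * 1ℚ + sumFin (λ j → g (suc j) * 0ℚ)
    ≡⟨ cong₂ _+_ (ℚP.*-identityʳ (g zero)) (sumFin-zero (λ j → ℚP.*-zeroʳ (g (suc j)))) ⟩
  g zero + 0ℚ
    ≡⟨ ℚP.+-identityʳ (g zero) ⟩
  g zero ∎
  where open ≡-Reasoning
sumFin-δ {suc n} g (suc a) =
  trans (cong₂ _+_ (ℚP.*-zeroʳ (g zero)) (sumFin-δ (g ∘ suc) a)) (ℚP.+-identityˡ (g (suc a)))

sumFin-δ-one : ∀ {n} (a : Fin n) → sumFin (δ a) ≡ 1ℚ
sumFin-δ-one a = trans (sumFin-cong (λ j → sym (ℚP.*-identityˡ (δ a j)))) (sumFin-δ (λ _ → 1ℚ) a)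

ZeroOne : ∀ {n} → (Fin n → ℚ) → Set
ZeroOne f = ∀ j → f j ≡ 0ℚ ⊎ f j ≡ 1ℚ

sumFin-zeroOne-nonNeg : ∀ {n} {f : Fin n → ℚ} → ZeroOne f → 0ℚ ≤ sumFin f
sumFin-zeroOne-nonNeg {zero}  _  = ℚP.≤-refl
sumFin-zeroOne-nonNeg {suc n} f01 = ℚP.+-mono-≤ (nonNeg (f01 zero)) (sumFin-zeroOne-nonNeg (f01 ∘ suc))
  where
  nonNeg : ∀ {a} → a ≡ 0ℚ ⊎ a ≡ 1ℚ → 0ℚ ≤ a
  nonNeg (inj₁ refl) = ℚP.≤-refl
  nonNeg (inj₂ refl) = ℚ.*≤* (ℤ.+≤+ ℕ.z≤n)

zeroOne-sum≡0 : ∀ {n} {f : Fin n → ℚ} → ZeroOne f → sumFin f ≡ 0ℚ → ∀ j → f j ≡ 0ℚ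
zeroOne-sum≡0 {suc n} {f} f01 sum≡0 with f01 zero
... | inj₁ f₀≡0 = λ where
  zero    → f₀≡0
  (suc j) → zeroOne-sum≡0 (f01 ∘ suc) (sumFin-tail f f₀≡0 sum≡0) j
... | inj₂ f₀≡1 =
  ⊥-elim (1+nonNeg≢0 (sumFin-zeroOne-nonNeg (f01 ∘ suc)) (sumFin-head f f₀≡1 sum≡0))

zeroOne-sum≡1 : ∀ {n} {f : Fin n → ℚ} → ZeroOne f → sumFin f ≡ 1ℚ →
  Σ[ a ∈ Fin n ] (∀ j → f j ≡ δ a j)
zeroOne-sum≡1 {zero} _ ()
zeroOne-sum≡1 {suc n} {f} f01 sum≡1 with f01 zero
... | inj₁ f₀≡0
  with a , f∘suc≗δa ← zeroOne-sum≡1 (f01 ∘ suc) (sumFin-tail f f₀≡0 sum≡1) = suc a , λ where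
  zero    → f₀≡0
  (suc j) → f∘suc≗δa j
... | inj₂ f₀≡1 = zero , λ where
  zero    → f₀≡1
  (suc j) → zeroOne-sum≡0 (f01 ∘ suc) (p+q≡p⇒q≡0 1ℚ _ (sumFin-head f f₀≡1 sum≡1)) j

IsPermutation : ∀ {n} → (Fin n → Fin n) → Set
IsPermutation {n} σ = map σ (allFin n) ↭ allFin n

inverse⇒isPermutation : ∀ {n} {σ ρ : Fin n → Fin n} →
  (∀ j → σ (ρ j) ≡ j) → (∀ i → ρ (σ i) ≡ i) → IsPermutation σ
inverse⇒isPermutation {n} {σ} {ρ} σ∘ρ ρ∘σ = ∼bag⇒↭ (unique∧set⇒bag
  (Unique.map⁺ σ-injective (Unique.allFin⁺ n)) (Unique.allFin⁺ n)
  (λ {j} → mk⇔ (λ _ → ∈-allFin j)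
               (λ _ → subst (_∈ᴸ map σ (allFin n)) (σ∘ρ j) (∈-map⁺ σ (∈-allFin (ρ j))))))
  where
  σ-injective : ∀ {i i′} → σ i ≡ σ i′ → i ≡ i′
  σ-injective {i} {i′} σi≡σi′ = trans (sym (ρ∘σ i)) (trans (cong ρ σi≡σi′) (ρ∘σ i′))

isPermutation-filter : ∀ {n} {σ : Fin n → Fin n} → IsPermutation σ → ∀ t →
  map σ (filterᵇ (t ∘ σ) (allFin n)) ↭ filterᵇ t (allFin n)
isPermutation-filter {n} {σ} σ-perm t =
  subst (_↭ filterᵇ t (allFin n)) (filterᵇ-map t σ (allFin n)) (↭.filter-↭ (T? ∘ t) σ-perm)

permMatrix⇒permutation : ∀ {n} {x : Fin n → Fin n → ℚ} → IsPermMatrix n x →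
  Σ[ σ ∈ (Fin n → Fin n) ] (IsPermutation σ × (∀ i j → x i j ≡ δ (σ i) j))
permMatrix⇒permutation {n} {x} (x01 , colSum , rowSum) = σ , inverse⇒isPermutation σ∘ρ ρ∘σ , x≗δσ
  where
  row : ∀ i → Σ[ a ∈ Fin n ] (∀ j → x i j ≡ δ a j)
  row i = zeroOne-sum≡1 (x01 i) (rowSum i)
  col : ∀ j → Σ[ a ∈ Fin n ] (∀ i → x i j ≡ δ a i)
  col j = zeroOne-sum≡1 (λ i → x01 i j) (colSum j)
  σ ρ : Fin n → Fin n
  σ = proj₁ ∘ row
  ρ = proj₁ ∘ col
  x≗δσ : ∀ i j → x i j ≡ δ (σ i) j
  x≗δσ i = proj₂ (row i)
  x≗δρ : ∀ i j → x i j ≡ δ (ρ j) i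
  x≗δρ i j = proj₂ (col j) i
  σ∘ρ : ∀ j → σ (ρ j) ≡ j
  σ∘ρ j = δ≡1⇒≡ (trans (sym (x≗δσ (ρ j) j)) (trans (x≗δρ (ρ j) j) (δ-diag (ρ j))))
  ρ∘σ : ∀ i → ρ (σ i) ≡ i
  ρ∘σ i = δ≡1⇒≡ (trans (sym (x≗δρ i (σ i))) (trans (x≗δσ i (σ i)) (δ-diag (σ i))))

permutation⇒permMatrix : ∀ {n} {σ : Fin n → Fin n} → IsPermutation σ →
  IsPermMatrix n (λ i j → δ (σ i) j)
permutation⇒permMatrix {n} {σ} σ-perm = (λ i → δ-zeroOne (σ i)) , colSum , (λ i → sumFin-δ-one (σ i))
  where
  colSum : ∀ j → sumFin (λ i → δ (σ i) j) ≡ 1ℚ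
  colSum j = begin
    sumFin (λ i → δ (σ i) j)                      ≡⟨ sumFin-as-sumᴸ (λ i → δ (σ i) j) ⟩
    sumᴸ (map (λ i → δ (σ i) j) (allFin n))       ≡⟨ cong sumᴸ (ListP.map-∘ (allFin n)) ⟩
    sumᴸ (map (λ k → δ k j) (map σ (allFin n)))   ≡⟨ sumᴸ-↭ (↭.map⁺ (λ k → δ k j) σ-perm) ⟩
    sumᴸ (map (λ k → δ k j) (allFin n))           ≡⟨ sumFin-as-sumᴸ (λ k → δ k j) ⟨
    sumFin (λ k → δ k j)                          ≡⟨ sumFin-cong (λ k → δ-sym k j) ⟩
    sumFin (δ j)                                  ≡⟨ sumFin-δ-one j ⟩
    1ℚ                                            ∎
    where open ≡-Reasoning

weight-antitone : ∀ n → AllPairs (λ i j → weight n i ≥ weight n j) (allFin n)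
weight-antitone n = AllPairs.tabulate⁺-< (λ i<j → ℕ→ℚ-mono-≤ (ℕP.∸-monoʳ-≤ n (ℕP.<⇒≤ i<j)))

-- wsum n gives weight 0 to the entries beyond the n-th, just as zip drops them.
wsum-as-dot : ∀ n es → wsum n es ≡ dot (map (weight n) (allFin n)) es
wsum-as-dot n es = trans (as-tabulate n es) (cong (λ ws → dot ws es) (sym (ListP.map-tabulate id (weight n))))
  where
  wsum-zero : ∀ es → wsum 0 es ≡ 0ℚ
  wsum-zero []       = refl
  wsum-zero (e ∷ es) = trans (cong₂ _+_ (ℚP.*-zeroˡ e) (wsum-zero es)) (ℚP.+-identityˡ 0ℚ)
  as-tabulate : ∀ n es → wsum n es ≡ dot (tabulate (weight n)) es
  as-tabulate zero    es       = wsum-zero es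
  as-tabulate (suc n) []       = refl
  as-tabulate (suc n) (e ∷ es) = cong (ℕ→ℚ (suc n) * e +_) (as-tabulate n es)

cost-δ : ∀ {n} (p : Fin n → ℚ) {x : Fin n → Fin n → ℚ} {σ : Fin n → Fin n} →
  (∀ i j → x i j ≡ δ (σ i) j) → cost n p x ≡ sumFin (λ i → weight n i * p (σ i))
cost-δ {n} p {x} {σ} x≗δσ = sumFin-cong λ i → begin
  sumFin (λ j → p j * weight n i * x i j)
    ≡⟨ sumFin-cong (λ j → cong (p j * weight n i *_) (x≗δσ i j)) ⟩
  sumFin (λ j → p j * weight n i * δ (σ i) j)
    ≡⟨ sumFin-δ (λ j → p j * weight n i) (σ i) ⟩
  p (σ i) * weight n i
    ≡⟨ ℚP.*-comm (p (σ i)) (weight n i) ⟩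
  weight n i * p (σ i) ∎
  where open ≡-Reasoning

scheduleCost : ∀ n → (p q : Fin n → ℚ) → (σ τ : Fin n → Fin n) → ℚ
scheduleCost n p q σ τ = pairing (map (λ i → (weight n i , p (σ i) + q (τ i))) (allFin n))

objective-δ : ∀ {n} (p q : Fin n → ℚ) {x y : Fin n → Fin n → ℚ} {σ τ : Fin n → Fin n} →
  (∀ i j → x i j ≡ δ (σ i) j) → (∀ i j → y i j ≡ δ (τ i) j) →
  objective n p q x y ≡ scheduleCost n p q σ τ
objective-δ {n} p q {x} {y} {σ} {τ} x≗δσ y≗δτ = begin
  cost n p x + cost n q y
    ≡⟨ cong₂ _+_ (trans (cost-δ p x≗δσ) (sumFin-as-pairing (weight n) (p ∘ σ)))
                 (trans (cost-δ q y≗δτ) (sumFin-as-pairing (weight n) (q ∘ τ))) ⟩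
  pairing (map (λ i → (weight n i , p (σ i))) (allFin n))
    + pairing (map (λ i → (weight n i , q (τ i))) (allFin n))
    ≡⟨ pairing-map-+ (weight n) (p ∘ σ) (q ∘ τ) (allFin n) ⟨
  scheduleCost n p q σ τ ∎
  where open ≡-Reasoning

-- The constraint x_ij = y_ij (j ∈ M) at a position running u on stage 1 and v on stage 2.
Coupled : ∀ {n} → Subset n → Fin n × Fin n → Set
Coupled M (u , v) = u ≡ v ⊎ (u ∉ M × v ∉ M)

∉⇒lookup≡false : ∀ {n} {M : Subset n} {u} → u ∉ M → lookup M u ≡ false
∉⇒lookup≡false {M = M} {u} u∉M with lookup M u in eq
... | true  = ⊥-elim (u∉M (lookup⇒[]= u M eq))
... | false = refl

notInM-∉ : ∀ {n} (M : Subset n) → All (_∉ M) (notInM M)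
notInM-∉ M = All.map (λ {j} j∉ j∈M → subst (T ∘ not) ([]=⇒lookup j∈M) j∉)
  (All.all-filter (T? ∘ not ∘ lookup M) (allFin _))

coupled⇒δ-agree : ∀ {n} {M : Subset n} {u v} → Coupled M (u , v) → ∀ j → j ∈ M → δ u j ≡ δ v j
coupled⇒δ-agree (inj₁ refl)            j j∈M = refl
coupled⇒δ-agree {u = u} {v} (inj₂ (u∉M , v∉M)) j j∈M =
  trans (δ-off {i = u} (λ { refl → u∉M j∈M })) (sym (δ-off {i = v} (λ { refl → v∉M j∈M })))

δ-agree⇒coupled : ∀ {n} {M : Subset n} {u v} → (∀ j → j ∈ M → δ u j ≡ δ v j) → Coupled M (u , v)
δ-agree⇒coupled {M = M} {u} {v} agree with u ∈? M | v ∈? M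
... | yes u∈M | _       = inj₁ (sym (δ≡1⇒≡ (trans (sym (agree u u∈M)) (δ-diag u))))
... | no  _   | yes v∈M = inj₁ (δ≡1⇒≡ (trans (agree v v∈M) (δ-diag v)))
... | no  u∉M | no  v∉M = inj₂ (u∉M , v∉M)

coupled-lookup : ∀ {n} {M : Subset n} {u v} → Coupled M (u , v) → lookup M u ≡ lookup M v
coupled-lookup (inj₁ refl)            = refl
coupled-lookup (inj₂ (u∉M , v∉M)) = trans (∉⇒lookup≡false u∉M) (sym (∉⇒lookup≡false v∉M))

coupled-inside : ∀ {n} {M : Subset n} {u v} → Coupled M (u , v) → T (lookup M u) → u ≡ v
coupled-inside (inj₁ u≡v)         _ = u≡v
coupled-inside (inj₂ (u∉M , _)) Mu with () ← subst T (∉⇒lookup≡false u∉M) Mu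

feasible⇒coupledPermutations : ∀ {n} {M : Subset n} {x y : Fin n → Fin n → ℚ} →
  Feasible n M x y →
  Σ[ σ ∈ (Fin n → Fin n) ] Σ[ τ ∈ (Fin n → Fin n) ]
    (IsPermutation σ × IsPermutation τ × (∀ i → Coupled M (σ i , τ i))
     × (∀ i j → x i j ≡ δ (σ i) j) × (∀ i j → y i j ≡ δ (τ i) j))
feasible⇒coupledPermutations (x-perm , y-perm , x≡y)
  with σ , σ-perm , x≗δσ ← permMatrix⇒permutation x-perm
  with τ , τ-perm , y≗δτ ← permMatrix⇒permutation y-perm
  = σ , τ , σ-perm , τ-perm
  , (λ i → δ-agree⇒coupled (λ j j∈M → trans (sym (x≗δσ i j)) (trans (x≡y i j j∈M) (y≗δτ i j))))
  , x≗δσ , y≗δτ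

coupledPermutations⇒feasible : ∀ {n} {M : Subset n} {σ τ : Fin n → Fin n} →
  IsPermutation σ → IsPermutation τ → (∀ i → Coupled M (σ i , τ i)) →
  Feasible n M (λ i j → δ (σ i) j) (λ i j → δ (τ i) j)
coupledPermutations⇒feasible σ-perm τ-perm coupled =
  permutation⇒permMatrix σ-perm , permutation⇒permMatrix τ-perm , (λ i → coupled⇒δ-agree (coupled i))

module LowerBound {n} (p q : Fin n → ℚ) (M : Subset n) {σ τ : Fin n → Fin n}
  (σ-perm : IsPermutation σ) (τ-perm : IsPermutation τ) (coupled : ∀ i → Coupled M (σ i , τ i)) where

  private
    w c : Fin n → ℚ
    w = weight n
    c j = p j + q j

    a b d : List ℚ
    a = sort (map p (notInM M))
    b = sort (map q (notInM M))
    d = zipWith _+_ a b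

    h : Fin n → ℚ × ℚ
    h i = (w i , p (σ i) + q (τ i))

    inside outside : List (Fin n)
    inside  = filterᵇ (lookup M ∘ σ) (allFin n)
    outside = filterᵇ (not ∘ lookup M ∘ σ) (allFin n)

    σ-inside : map σ inside ↭ inM M
    σ-inside = isPermutation-filter σ-perm (lookup M)

    σ-outside : map σ outside ↭ notInM M
    σ-outside = isPermutation-filter σ-perm (not ∘ lookup M)

    τ-outside : map τ outside ↭ notInM M
    τ-outside = subst (λ ps → map τ ps ↭ notInM M)
      (filterᵇ-cong (λ i → cong not (sym (coupled-lookup (coupled i)))) (allFin n))
      (isPermutation-filter τ-perm (not ∘ lookup M))

    sort-outside : ∀ (f : Fin n → ℚ) {π : Fin n → Fin n} → map π outside ↭ notInM M →
      sort (map (f ∘ π) outside) ≡ sort (map f (notInM M))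
    sort-outside f π-outside =
      sort-↭-cong (↭-trans (↭-reflexive (ListP.map-∘ outside)) (↭.map⁺ f π-outside))

    length-outside : length (map w outside) ≡ length d
    length-outside = begin
      length (map w outside)                  ≡⟨ ListP.length-map w outside ⟩
      length outside                          ≡⟨ ListP.length-map σ outside ⟨
      length (map σ outside)                  ≡⟨ ↭.↭-length σ-outside ⟩
      length (notInM M)                       ≡⟨ ℕP.⊓-idem _ ⟨
      length (notInM M) ℕ.⊓ length (notInM M) ≡⟨ cong₂ ℕ._⊓_ (length-sort-map p _) (length-sort-map q _) ⟨
      length a ℕ.⊓ length b                   ≡⟨ ListP.length-zipWith _+_ a b ⟨
      length d                                ∎
      where open ≡-Reasoning

    insideTerms outsideTerms merged : List (ℚ × ℚ)
    insideTerms  = map (λ i → (w i , c (σ i))) inside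
    outsideTerms = zip (map w outside) d
    merged       = insideTerms ++ outsideTerms

    inside-part : pairing (map h inside) ≡ pairing insideTerms
    inside-part = cong pairing (ListP.map-cong-local (All.map
      (λ {i} Mσi → cong (λ k → (w i , p (σ i) + q k)) (sym (coupled-inside (coupled i) Mσi)))
      (All.all-filter (T? ∘ lookup M ∘ σ) (allFin n))))

    outside-part : dot (map w outside) d ≤ pairing (map h outside)
    outside-part = subst₂ (λ a′ b′ → dot (map w outside) (zipWith _+_ a′ b′) ≤ pairing (map h outside))
      (sort-outside p σ-outside) (sort-outside q τ-outside)
      (two-sorted-sums-bound w (p ∘ σ) (q ∘ τ) outside
        (AllPairs.filter⁺ (T? ∘ not ∘ lookup M ∘ σ) (weight-antitone n)))

    merged-weights : map w (allFin n) ↭ map proj₁ merged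
    merged-weights = begin
      map w (allFin n)
        ↭⟨ ↭.map⁺ w (partitionᵇ-↭ (lookup M ∘ σ) (allFin n)) ⟨
      map w (inside ++ outside)
        ≡⟨ ListP.map-++ w inside outside ⟩
      map w inside ++ map w outside
        ≡⟨ cong₂ _++_ (ListP.map-∘ inside) (sym (map-proj₁-zip _ d length-outside)) ⟩
      map proj₁ insideTerms ++ map proj₁ outsideTerms
        ≡⟨ ListP.map-++ proj₁ insideTerms outsideTerms ⟨
      map proj₁ merged ∎
      where open PermutationReasoning

    merged-values : eVec n p q M ↭ map proj₂ merged
    merged-values = begin
      eVec n p q M
        ↭⟨ sort-↭ _ ⟩
      map c (inM M) ++ d
        ↭⟨ ↭.++⁺ʳ d (↭.map⁺ c σ-inside) ⟨
      map c (map σ inside) ++ d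
        ≡⟨ cong₂ _++_ (trans (sym (ListP.map-∘ inside)) (ListP.map-∘ inside))
                      (sym (map-proj₂-zip _ d length-outside)) ⟩
      map proj₂ insideTerms ++ map proj₂ outsideTerms
        ≡⟨ ListP.map-++ proj₂ insideTerms outsideTerms ⟨
      map proj₂ merged ∎
      where open PermutationReasoning

  lower-bound : wsum n (eVec n p q M) ≤ scheduleCost n p q σ τ
  lower-bound = begin
    wsum n (eVec n p q M)
      ≡⟨ wsum-as-dot n _ ⟩
    dot (map w (allFin n)) (eVec n p q M)
      ≤⟨ rearrangement merged (AllPairs.map⁺ (weight-antitone n)) (sort-allPairs _) merged-weights merged-values ⟩
    pairing merged
      ≡⟨ pairing-++ insideTerms outsideTerms ⟩
    pairing insideTerms + dot (map w outside) d
      ≤⟨ ℚP.+-mono-≤ (ℚP.≤-reflexive (sym inside-part)) outside-part ⟩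
    pairing (map h inside) + pairing (map h outside)
      ≡⟨ pairing-map-partition h (lookup M ∘ σ) (allFin n) ⟨
    scheduleCost n p q σ τ ∎
    where open ℚP.≤-Reasoning

module Attainment {n} (p q : Fin n → ℚ) (M : Subset n) where

  private
    val : Fin n × Fin n → ℚ
    val t = p (proj₁ t) + q (proj₂ t)

    byP byQ : List (Fin n)
    byP = SortOn.sortOn p (notInM M)
    byQ = SortOn.sortOn q (notInM M)

    length-byP≡byQ : length byP ≡ length byQ
    length-byP≡byQ =
      trans (↭.↭-length (SortOn.sortOn-↭ p _)) (sym (↭.↭-length (SortOn.sortOn-↭ q _)))

    pairs sortedPairs : List (Fin n × Fin n)
    pairs = map (λ j → (j , j)) (inM M) ++ zip byP byQ
    sortedPairs = SortOn.sortOn val pairs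

    projection-perm : ∀ (π : Fin n × Fin n → Fin n) (byπ : List (Fin n)) → (∀ j → π (j , j) ≡ j) →
      map π (zip byP byQ) ≡ byπ → byπ ↭ notInM M → map π sortedPairs ↭ allFin n
    projection-perm π byπ π-diag π-zip byπ↭ = begin
      map π sortedPairs                                  ↭⟨ ↭.map⁺ π (SortOn.sortOn-↭ val pairs) ⟩
      map π pairs                                        ≡⟨ ListP.map-++ π _ (zip byP byQ) ⟩
      map π (map (λ j → (j , j)) (inM M)) ++ map π (zip byP byQ)
        ≡⟨ cong₂ _++_ (trans (sym (ListP.map-∘ (inM M))) (ListP.map-cong π-diag (inM M))) π-zip ⟩
      map id (inM M) ++ byπ                              ≡⟨ cong (_++ byπ) (ListP.map-id (inM M)) ⟩
      inM M ++ byπ                                       ↭⟨ ↭.++⁺ˡ (inM M) byπ↭ ⟩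
      inM M ++ notInM M                                  ↭⟨ partitionᵇ-↭ (lookup M) (allFin n) ⟩
      allFin n                                           ∎
      where open PermutationReasoning

    σ-perm : map proj₁ sortedPairs ↭ allFin n
    σ-perm = projection-perm proj₁ byP (λ _ → refl)
      (map-proj₁-zip byP byQ length-byP≡byQ) (SortOn.sortOn-↭ p _)

    τ-perm : map proj₂ sortedPairs ↭ allFin n
    τ-perm = projection-perm proj₂ byQ (λ _ → refl)
      (map-proj₂-zip byP byQ length-byP≡byQ) (SortOn.sortOn-↭ q _)

    length-sortedPairs : length sortedPairs ≡ n
    length-sortedPairs = trans (sym (ListP.length-map proj₁ sortedPairs))
      (trans (↭.↭-length σ-perm) (ListP.length-tabulate id))

    sortedPairs-coupled : All (Coupled M) sortedPairs
    sortedPairs-coupled = ↭.All-resp-↭ (↭-sym (SortOn.sortOn-↭ val pairs)) (All.++⁺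
      (All.map⁺ (All.universal (λ _ → inj₁ refl) (inM M)))
      (All.map inj₂ (all-zip (↭.All-resp-↭ (↭-sym (SortOn.sortOn-↭ p _)) (notInM-∉ M))
                             (↭.All-resp-↭ (↭-sym (SortOn.sortOn-↭ q _)) (notInM-∉ M)))))

    sortedPairs-values : map val sortedPairs ≡ eVec n p q M
    sortedPairs-values = begin
      map val sortedPairs
        ≡⟨ SortOn.map-sortOn val pairs ⟩
      sort (map val pairs)
        ≡⟨ cong sort (ListP.map-++ val _ (zip byP byQ)) ⟩
      sort (map val (map (λ j → (j , j)) (inM M)) ++ map val (zip byP byQ))
        ≡⟨ cong sort (cong₂ _++_ (sym (ListP.map-∘ (inM M)))
                 (trans (ListP.map-zipWith _,_ val byP byQ) (sym (ListP.zipWith-map _+_ p q byP byQ)))) ⟩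
      sort (map (λ j → p j + q j) (inM M) ++ zipWith _+_ (map p byP) (map q byQ))
        ≡⟨ cong (λ ds → sort (map (λ j → p j + q j) (inM M) ++ ds))
                (cong₂ (zipWith _+_) (SortOn.map-sortOn p _) (SortOn.map-sortOn q _)) ⟩
      eVec n p q M ∎
      where open ≡-Reasoning

    π : Fin n → Fin n × Fin n
    π = fromList sortedPairs length-sortedPairs

  optimal-schedule : Σ[ σ ∈ (Fin n → Fin n) ] Σ[ τ ∈ (Fin n → Fin n) ]
    (IsPermutation σ × IsPermutation τ × (∀ i → Coupled M (σ i , τ i))
     × scheduleCost n p q σ τ ≡ wsum n (eVec n p q M))
  optimal-schedule = proj₁ ∘ π , proj₂ ∘ π
    , subst (_↭ allFin n) (along proj₁) σ-perm
    , subst (_↭ allFin n) (along proj₂) τ-perm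
    , (λ i → All.lookup sortedPairs-coupled
               (subst (π i ∈ᴸ_) (map-fromList sortedPairs length-sortedPairs) (∈-map⁺ π (∈-allFin i))))
    , schedule-cost
    where
    along : ∀ {B : Set} (f : Fin n × Fin n → B) → map f sortedPairs ≡ map (f ∘ π) (allFin n)
    along f = trans (cong (map f) (sym (map-fromList sortedPairs length-sortedPairs)))
                    (sym (ListP.map-∘ (allFin n)))
    schedule-cost : scheduleCost n p q (proj₁ ∘ π) (proj₂ ∘ π) ≡ wsum n (eVec n p q M)
    schedule-cost = begin
      pairing (map (λ i → (weight n i , val (π i))) (allFin n))
        ≡⟨ cong pairing (map-pair (weight n) (val ∘ π) (allFin n)) ⟩
      dot (map (weight n) (allFin n)) (map (val ∘ π) (allFin n))
        ≡⟨ cong (dot (map (weight n) (allFin n))) (trans (sym (along val)) sortedPairs-values) ⟩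
      dot (map (weight n) (allFin n)) (eVec n p q M)
        ≡⟨ wsum-as-dot n _ ⟨
      wsum n (eVec n p q M) ∎
      where open ≡-Reasoning

theorem1 : (n : ℕ) (p q : Fin n → ℚ) (M : Subset n) →
    (∀ j → 0ℚ ≤ p j) → (∀ j → 0ℚ ≤ q j) →
    (Σ[ x ∈ (Fin n → Fin n → ℚ) ] Σ[ y ∈ (Fin n → Fin n → ℚ) ]
        (Feasible n M x y × objective n p q x y ≡ wsum n (eVec n p q M)))
    × (∀ x y → Feasible n M x y → wsum n (eVec n p q M) ≤ objective n p q x y)
theorem1 n p q M _ _ = attained , bounded
  where
  attained : Σ[ x ∈ (Fin n → Fin n → ℚ) ] Σ[ y ∈ (Fin n → Fin n → ℚ) ]
    (Feasible n M x y × objective n p q x y ≡ wsum n (eVec n p q M))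
  attained with σ , τ , σ-perm , τ-perm , coupled , optimal ← Attainment.optimal-schedule p q M
    = (λ i j → δ (σ i) j) , (λ i j → δ (τ i) j)
    , coupledPermutations⇒feasible σ-perm τ-perm coupled
    , trans (objective-δ p q (λ _ _ → refl) (λ _ _ → refl)) optimal
  bounded : ∀ x y → Feasible n M x y → wsum n (eVec n p q M) ≤ objective n p q x y
  bounded x y feasible
    with σ , τ , σ-perm , τ-perm , coupled , x≗δσ , y≗δτ ← feasible⇒coupledPermutations feasible
    = subst (wsum n (eVec n p q M) ≤_) (sym (objective-δ p q x≗δσ y≗δτ))
        (LowerBound.lower-bound p q M σ-perm τ-perm coupled)
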